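{- For a pair $x=(L,U)$ of predicates on the rationals: (1) there is a function $\operatorname{isCut}^S(x)\to\operatorname{isDedekindCut}(x)$; (2) $\|\operatorname{isCut}^S(x)\|\Rightarrow\operatorname{isDedekindCut}(x)$; (3) there is a function $\operatorname{isDedekindCut}(x)\times\operatorname{locator}(x)\to\operatorname{isCut}^S(x)$; (4) $\operatorname{isDedekindCut}(x)\land\|\operatorname{locator}(x)\|\Rightarrow\operatorname{isCauchyReal}(x)$; (5) $\|\operatorname{isCut}^S(x)\|\Rightarrow\operatorname{isCauchyReal}(x)$.
   Context: Work in Martin-Löf type theory with propositional truncation $\|\cdot\|$, function extensionality and propositional extensionality; $\land,\lor,\exists$ are truncated ($P\lor Q=\|P+Q\|$, $\exists=\|\Sigma\|$). For $L,U$ proposition-valued predicates on $\mathbb{Q}$ write $q<x$ for $q\in L$, $x<r$ for $r\in U$. $\operatorname{isDedekindCut}(x)$ is the conjunction of: $\exists q.\,q<x$; $\exists r.\,x<r$; $\forall q,q'.\,(q<q')\land(q'<x)\Rightarrow q<x$; $\forall r,r'.\,(r'<r)\land(x<r')\Rightarrow x<r$; $\forall q.\,q<x\Rightarrow\exists q'.\,(q<q')\land(q'<x)$; $\forall r.\,x<r\Rightarrow\exists r'.\,(r'<r)\land(x<r')$; $\forall q,r.\,(q<x)\land(x<r)\Rightarrow q<r$; $\forall q,r.\,(q<r)\Rightarrow(q<x)\lor(x<r)$. $\operatorname{isCut}^S(x)$ is the (untruncated) product of: $\sum_{q}q<x$; $\sum_r x<r$; $\prod_{q,q'}(q<q')\times(q'<x)\to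 q<x$; $\prod_{r,r'}(r'<r)\times(x<r')\to x<r$; $\prod_q (q<x)\to\sum_{q'}(q<q')\times(q'<x)$; $\prod_r(x<r)\to\sum_{r'}(r'<r)\times(x<r')$; $\prod_{q,r}(q<x)\times(x<r)\to q<r$; and $\operatorname{locator}(x):=\prod_{q,r:\mathbb{Q}}(q<r)\to(q<x)+(x<r)$ (untruncated sum). $\operatorname{isCauchyReal}(x)$ means that $x$ is a Dedekind cut which lies in the image of the canonical inclusion of the Cauchy reals into the Dedekind reals, equivalently that there exists a Cauchy sequence of rationals (with modulus of convergence) whose limit is $x$. -}

module Defs where

open import Level using (0ℓ)
open import Data.Nat as ℕ using (ℕ)
open import Data.Rational using (ℚ; _<_; _+_; _-_; 0ℚ) renaming (∣_∣ to abs)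
open import Data.Product using (Σ; _×_; Σ-syntax)
open import Data.Sum using (_⊎_)
open import Relation.Nullary using (Irrelevant)
open import Relation.Binary.PropositionalEquality using (_≡_)
open import Axiom.Extensionality.Propositional using (Extensionality)

isProp : Set → Set
isProp = Irrelevant

-- The ambient propositional truncation ‖_‖ (a HIT, not definable in
-- --safe Agda), given axiomatically by its formation, propositionality,
-- introduction and recursion principle into propositions.
record PropTrunc : Set₁ where
  field
    ∥_∥      : Set → Set
    ∥∥-isProp : (A : Set) → isProp ∥ A ∥
    ∣_∣      : {A : Set} → A → ∥ A ∥
    ∥∥-rec   : {A P : Set} → isProp P → (A → P) → ∥ A ∥ → P

FunExt : Set₁
FunExt = Extensionality 0ℓ 0ℓ

PropExt : Set₁
PropExt = {P Q : Set} → isProp P → isProp Q → (P → Q) → (Q → P) → P ≡ Q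

Pred : Set₁
Pred = ℚ → Set

module _ (T : PropTrunc) where
  open PropTrunc T

  _∨_ : Set → Set → Set
  P ∨ Q = ∥ P ⊎ Q ∥

  ∃ᵗ : {A : Set} → (A → Set) → Set
  ∃ᵗ {A} B = ∥ Σ A B ∥

  -- x = (L , U);  q < x  means  L q ;  x < r  means  U r
  isDedekindCut : Pred → Pred → Set
  isDedekindCut L U =
      ∃ᵗ (λ q → L q)
    × ∃ᵗ (λ r → U r)
    × ((q q' : ℚ) → (q < q') × L q' → L q)
    × ((r r' : ℚ) → (r' < r) × U r' → U r)
    × ((q : ℚ) → L q → ∃ᵗ (λ q' → (q < q') × L q'))
    × ((r : ℚ) → U r → ∃ᵗ (λ r' → (r' < r) × U r'))
    × ((q r : ℚ) → L q × U r → q < r)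
    × ((q r : ℚ) → q < r → L q ∨ U r)

  isCauchyWithModulus : (ℕ → ℚ) → (ℚ → ℕ) → Set
  isCauchyWithModulus f M =
    (ε : ℚ) → 0ℚ < ε → (m n : ℕ) → M ε ℕ.≤ m → M ε ℕ.≤ n → abs (f m - f n) < ε

  hasLimit : (ℕ → ℚ) → Pred → Pred → Set
  hasLimit f L U =
    (ε : ℚ) → 0ℚ < ε →
      ∃ᵗ (λ (N : ℕ) → (n : ℕ) → N ℕ.≤ n → L (f n - ε) × U (f n + ε))

  isCauchyReal : Pred → Pred → Set
  isCauchyReal L U =
    isDedekindCut L U ×
    ∃ᵗ (λ (fM : Σ (ℕ → ℚ) (λ _ → ℚ → ℕ)) →
          isCauchyWithModulus (Data.Product.proj₁ fM) (Data.Product.proj₂ fM)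
        × hasLimit (Data.Product.proj₁ fM) L U)

locator : Pred → Pred → Set
locator L U = (q r : ℚ) → q < r → L q ⊎ U r

isCutS : Pred → Pred → Set
isCutS L U =
    Σ ℚ (λ q → L q)
  × Σ ℚ (λ r → U r)
  × ((q q' : ℚ) → (q < q') × L q' → L q)
  × ((r r' : ℚ) → (r' < r) × U r' → U r)
  × ((q : ℚ) → L q → Σ ℚ (λ q' → (q < q') × L q'))
  × ((r : ℚ) → U r → Σ ℚ (λ r' → (r' < r) × U r'))
  × ((q r : ℚ) → L q × U r → q < r)
  × locator L U

module Submission where

-- (1) Forgetting structure: every Σ and ⊎ in isCutS is sent to its truncation.
-- (2) isDedekindCut is a proposition (all its components are, by funext), so
--     (1) factors through the truncation of isCutS.
-- (3) A locator turns the truncated existentials of a Dedekind cut into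
--     explicit witnesses.  Along a monotone ladder of rationals the locator
--     decides at every rung on which side of the cut it lies; "the locator
--     answered left at rung n" is a decidable proposition, and a merely
--     existing such n becomes an explicit one by taking the least
--     (choice for decidable propositions on ℕ).  The ladders ∓n give
--     inhabitedness, the ladders q ± (2/3)ⁿ give roundedness.
-- (4) For a structured cut, repeated trisection with the locator produces
--     brackets lo ∈ L, hi ∈ U of width (r₀ - q₀)·(2/3)ⁿ; their lower ends form
--     a Cauchy sequence converging to the cut.  The Cauchy data is truncated in
--     isCauchyReal, so a merely given locator suffices.
-- (5) Combine (2), (4) and the locator component of isCutS.

open import Defs
open import Data.Nat as ℕ using (ℕ; zero; suc)
import Data.Nat.Properties as ℕP
open import Data.Nat.Coprimality using (1-coprimeTo) renaming (sym to coprime-sym)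
open import Data.Integer as ℤ using (+_)
import Data.Integer.Properties as ℤP
import Data.Integer.Solver as ℤSolver
open import Data.Rational renaming (∣_∣ to abs)
open import Data.Rational.Properties
import Data.Rational.Unnormalised as ℚᵘ
import Data.Rational.Unnormalised.Properties as ℚᵘP
import Data.Rational.Solver as ℚSolver
open import Data.Product using (Σ; _×_; _,_; proj₁; proj₂)
open import Data.Sum using (_⊎_; inj₁; inj₂; swap)
open import Data.Unit using (⊤; tt)
open import Data.Empty using (⊥; ⊥-elim)
open import Relation.Nullary using (¬_; Dec; yes; no)
open import Relation.Binary.PropositionalEquality
open import Relation.Binary.Definitions using (tri<; tri≈; tri>)

×-isProp : {A B : Set} → isProp A → isProp B → isProp (A × B)
×-isProp A-prop B-prop (a , b) (a' , b') = cong₂ _,_ (A-prop a a') (B-prop b b')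

Π-isProp : FunExt → {A : Set} {B : A → Set} →
  ((a : A) → isProp (B a)) → isProp ((a : A) → B a)
Π-isProp fe B-prop f g = fe (λ a → B-prop a (f a) (g a))

Least : (ℕ → Set) → Set
Least P = Σ ℕ (λ n → P n × ((m : ℕ) → m ℕ.< n → ¬ P m))

Least-isProp : FunExt → {P : ℕ → Set} → ((n : ℕ) → isProp (P n)) → isProp (Least P)
Least-isProp fe P-prop (n , p , below) (n' , p' , below') with ℕP.<-cmp n n'
... | tri< n<n' _ _ = ⊥-elim (below' n n<n' p)
... | tri> _ _ n'<n = ⊥-elim (below n' n'<n p')
... | tri≈ _ refl _ =
  cong₂ (λ x y → n , x , y) (P-prop n p p')
        (fe λ m → fe λ m<n → fe λ pm → ⊥-elim (below m m<n pm))

module _ {P : ℕ → Set} (P? : (n : ℕ) → Dec (P n)) where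

  searchBelow : (n : ℕ) → Least P ⊎ ((m : ℕ) → m ℕ.< n → ¬ P m)
  searchBelow zero = inj₂ (λ m ())
  searchBelow (suc n) with searchBelow n | P? n
  ... | inj₁ least | _ = inj₁ least
  ... | inj₂ none | yes p = inj₁ (n , p , none)
  ... | inj₂ none | no ¬p = inj₂ none-below-suc
    where
    none-below-suc : (m : ℕ) → m ℕ.< suc n → ¬ P m
    none-below-suc m m<1+n with ℕP.m<1+n⇒m<n∨m≡n m<1+n
    ... | inj₁ m<n = none m m<n
    ... | inj₂ refl = ¬p

  least : (n : ℕ) → P n → Least P
  least n p with searchBelow (suc n)
  ... | inj₁ l = l
  ... | inj₂ none = ⊥-elim (none n (ℕP.n<1+n n) p)

IsLeft : {A B : Set} → A ⊎ B → Set
IsLeft (inj₁ _) = ⊤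
IsLeft (inj₂ _) = ⊥

IsLeft? : {A B : Set} (x : A ⊎ B) → Dec (IsLeft x)
IsLeft? (inj₁ _) = yes tt
IsLeft? (inj₂ _) = no (λ ())

IsLeft-isProp : {A B : Set} (x : A ⊎ B) → isProp (IsLeft x)
IsLeft-isProp (inj₁ _) tt tt = refl

fromLeft : {A B : Set} (x : A ⊎ B) → IsLeft x → A
fromLeft (inj₁ a) _ = a

left-unless-right : {A B : Set} (x : A ⊎ B) → ¬ B → IsLeft x
left-unless-right (inj₁ _) _ = tt
left-unless-right (inj₂ b) ¬b = ¬b b

ι : ℕ → ℚ
ι zero = 0ℚ
ι (suc n) = ι n + 1ℚ

ℕ→ℚ : ℕ → ℚ
ℕ→ℚ n = mkℚ (+ n) 0 (coprime-sym (1-coprimeTo n))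

ℕ→ℚ-suc : (n : ℕ) → ℕ→ℚ (suc n) ≡ ℕ→ℚ n + 1ℚ
ℕ→ℚ-suc n = toℚᵘ-injective
    (ℚᵘP.≃-trans (ℚᵘ.*≡* numerators) (ℚᵘP.≃-sym (toℚᵘ-homo-+ (ℕ→ℚ n) 1ℚ)))
  where
  open ℤSolver.+-*-Solver
  numerators : (+ suc n) ℤ.* (+ 1) ≡ ((+ n) ℤ.* (+ 1) ℤ.+ (+ 1) ℤ.* (+ 1)) ℤ.* (+ 1)
  numerators = solve 1 (λ x → (con (+ 1) :+ x) :* con (+ 1)
                            := (x :* con (+ 1) :+ con (+ 1) :* con (+ 1)) :* con (+ 1)) refl (+ n)

ι-ℕ→ℚ : (n : ℕ) → ι n ≡ ℕ→ℚ n
ι-ℕ→ℚ zero = refl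
ι-ℕ→ℚ (suc n) = begin
  ι n + 1ℚ     ≡⟨ cong (_+ 1ℚ) (ι-ℕ→ℚ n) ⟩
  ℕ→ℚ n + 1ℚ   ≡⟨ ℕ→ℚ-suc n ⟨
  ℕ→ℚ (suc n)  ∎
  where open ≡-Reasoning

archimedean : (x : ℚ) → Σ ℕ (λ n → x < ι n)
archimedean x@(mkℚ (+ m) d _) = suc m , subst (x <_) (sym (ι-ℕ→ℚ (suc m))) (*<* m<1+m)
  where
  m<1+m : (+ m) ℤ.* (+ 1) ℤ.< (+ suc m) ℤ.* (+ suc d)
  m<1+m rewrite sym (ℤP.pos-* m 1) | sym (ℤP.pos-* (suc m) (suc d)) =
    ℤ.+<+ (ℕP.<-≤-trans (ℕ.s≤s (ℕP.≤-reflexive (ℕP.*-identityʳ m))) (ℕP.m≤m*n (suc m) (suc d)))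
archimedean (mkℚ ℤ.-[1+ m ] d _) = 0 , *<* ℤ.-<+

0<1 : 0ℚ < 1ℚ
0<1 = *<* (ℤ.+<+ (ℕ.s≤s ℕ.z≤n))

<-+-pos : (p : ℚ) {d : ℚ} → 0ℚ < d → p < p + d
<-+-pos p {d} d>0 = subst (_< p + d) (+-identityʳ p) (+-monoʳ-< p d>0)

≤-+-nonNeg : (p : ℚ) {d : ℚ} → 0ℚ ≤ d → p ≤ p + d
≤-+-nonNeg p {d} d≥0 = subst (_≤ p + d) (+-identityʳ p) (+-monoʳ-≤ p d≥0)

-‿pos-< : (p : ℚ) {d : ℚ} → 0ℚ < d → p - d < p
-‿pos-< p {d} d>0 = subst (p - d <_) (+-identityʳ p) (+-monoʳ-< p (neg-antimono-< d>0))

ι-<-suc : (n : ℕ) → ι n < ι (suc n)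
ι-<-suc n = <-+-pos (ι n) 0<1

ι-nonNeg : (n : ℕ) → 0ℚ ≤ ι n
ι-nonNeg zero = ≤-refl
ι-nonNeg (suc n) = <⇒≤ (≤-<-trans (ι-nonNeg n) (ι-<-suc n))

gap-pos : {p q : ℚ} → p < q → 0ℚ < q - p
gap-pos {p} {q} p<q = subst (_< q - p) (+-inverseʳ p) (+-monoˡ-< (- p) p<q)

p+[q-p]≡q : (p q : ℚ) → p + (q - p) ≡ q
p+[q-p]≡q = solve 2 (λ p q → p :+ (q :- p) := q) refl
  where open ℚSolver.+-*-Solver

+-below : (p q : ℚ) {d : ℚ} → d < q - p → p + d < q
+-below p q d<q-p = subst (p + _ <_) (p+[q-p]≡q p q) (+-monoʳ-< p d<q-p)

-‿above : (p q : ℚ) {d : ℚ} → d < p - q → q < p - d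
-‿above p q d<p-q = subst (_< p - _) (p-[p-q]≡q p q) (+-monoʳ-< p (neg-antimono-< d<p-q))
  where
  open ℚSolver.+-*-Solver
  p-[p-q]≡q : (p q : ℚ) → p - (p - q) ≡ q
  p-[p-q]≡q = solve 2 (λ p q → p :- (p :- q) := q) refl

<-+-from-gap : (p q : ℚ) {d : ℚ} → q - p < d → q < p + d
<-+-from-gap p q q-p<d = subst (_< p + _) (p+[q-p]≡q p q) (+-monoʳ-< p q-p<d)

abs-< : (p ε : ℚ) → p < ε → - p < ε → abs p < ε
abs-< p ε p<ε -p<ε with ∣p∣≡p∨∣p∣≡-p p
... | inj₁ ∣p∣≡p = subst (_< ε) (sym ∣p∣≡p) p<ε
... | inj₂ ∣p∣≡-p = subst (_< ε) (sym ∣p∣≡-p) -p<ε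

⅓ ⅔ : ℚ
⅓ = + 1 / 3
⅔ = + 2 / 3

third-of-pos : {p : ℚ} → 0ℚ < p → 0ℚ < p * ⅓
third-of-pos {p} p>0 = subst (_< p * ⅓) (*-zeroˡ ⅓) (*-monoˡ-<-pos ⅓ p>0)

geom : ℚ → ℕ → ℚ
geom w zero = w
geom w (suc n) = geom w n * ⅔

module _ (w : ℚ) (w>0 : 0ℚ < w) where

  geom-pos : (n : ℕ) → 0ℚ < geom w n
  geom-pos zero = w>0
  geom-pos (suc n) = subst (_< geom w n * ⅔) (*-zeroˡ ⅔) (*-monoˡ-<-pos ⅔ (geom-pos n))

  geom-decreasing : (n : ℕ) → geom w (suc n) < geom w n
  geom-decreasing n = subst (geom w (suc n) <_) (thirds (geom w n))
      (<-+-pos (geom w (suc n)) (third-of-pos (geom-pos n)))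
    where
    open ℚSolver.+-*-Solver
    thirds : (g : ℚ) → g * ⅔ + g * ⅓ ≡ g
    thirds = solve 1 (λ g → g :* con ⅔ :+ g :* con ⅓ := g) refl

  geom-antitone : {m n : ℕ} → m ℕ.≤ n → geom w n ≤ geom w m
  geom-antitone {m} {zero} ℕ.z≤n = ≤-refl
  geom-antitone {m} {suc n} m≤1+n with ℕP.m≤n⇒m<n∨m≡n m≤1+n
  ... | inj₁ m<1+n = <⇒≤ (<-≤-trans (geom-decreasing n) (geom-antitone (ℕP.m<1+n⇒m≤n m<1+n)))
  ... | inj₂ refl = ≤-refl

  -- Bernoulli's inequality (3/2)ⁿ ≥ 1 + n/2, in the form  w·(2/3)ⁿ·(n + 2) ≤ 2w.
  geom-bernoulli : (n : ℕ) → geom w n * ι (suc (suc n)) ≤ ι 2 * w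
  geom-bernoulli zero = ≤-reflexive (*-comm w (ι 2))
  geom-bernoulli (suc n) = ≤-trans shrink (geom-bernoulli n)
    where
    open ℚSolver.+-*-Solver
    g : ℚ
    g = geom w n
    split : (g i : ℚ) → g * (i + 1ℚ + 1ℚ) ≡ g * ⅔ * (i + 1ℚ + 1ℚ + 1ℚ) + g * ⅓ * i
    split = solve 2 (λ g i → g :* (i :+ con 1ℚ :+ con 1ℚ)
                      := g :* con ⅔ :* (i :+ con 1ℚ :+ con 1ℚ :+ con 1ℚ) :+ g :* con ⅓ :* i) refl
    remainder-nonNeg : 0ℚ ≤ g * ⅓ * ι n
    remainder-nonNeg = subst (_≤ g * ⅓ * ι n) (*-zeroˡ (ι n))
      (*-monoʳ-≤-nonNeg (ι n) {{nonNegative (ι-nonNeg n)}}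
        (<⇒≤ (third-of-pos (geom-pos n))))
    shrink : geom w (suc n) * ι (suc (suc (suc n))) ≤ g * ι (suc (suc n))
    shrink = subst (geom w (suc n) * ι (suc (suc (suc n))) ≤_) (sym (split g (ι n)))
               (≤-+-nonNeg (geom w (suc n) * ι (suc (suc (suc n)))) remainder-nonNeg)

  geom-vanishes : (ε : ℚ) → 0ℚ < ε → Σ ℕ (λ N → (n : ℕ) → N ℕ.≤ n → geom w n < ε)
  geom-vanishes ε ε>0 = N , λ n N≤n → ≤-<-trans (geom-antitone N≤n) geom-N<ε
    where
    instance
      ε-positive : Positive ε
      ε-positive = positive ε>0
      ε-nonZero : NonZero ε
      ε-nonZero = pos⇒nonZero ε
    N : ℕ
    N = proj₁ (archimedean (ι 2 * w * 1/ ε))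
    N+2 : ℚ
    N+2 = ι (suc (suc N))
    2w/ε<N+2 : ι 2 * w * 1/ ε < N+2
    2w/ε<N+2 = <-trans (proj₂ (archimedean (ι 2 * w * 1/ ε)))
                        (<-trans (ι-<-suc N) (ι-<-suc (suc N)))
    cancel : ι 2 * w * 1/ ε * ε ≡ ι 2 * w
    cancel = trans (*-assoc (ι 2 * w) (1/ ε) ε)
                   (trans (cong (ι 2 * w *_) (*-inverseˡ ε)) (*-identityʳ (ι 2 * w)))
    2w<ε[N+2] : ι 2 * w < ε * N+2
    2w<ε[N+2] = subst₂ _<_ cancel (*-comm N+2 ε) (*-monoˡ-<-pos ε 2w/ε<N+2)
    geom-N<ε : geom w N < ε
    geom-N<ε = *-cancelʳ-<-nonNeg N+2 {{nonNegative (ι-nonNeg (suc (suc N)))}}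
                 (≤-<-trans (geom-bernoulli N) 2w<ε[N+2])

module WithTruncation (T : PropTrunc) (fe : FunExt) where
  open PropTrunc T

  ∥∥-map : {A B : Set} → (A → B) → ∥ A ∥ → ∥ B ∥
  ∥∥-map {B = B} f = ∥∥-rec (∥∥-isProp B) (λ a → ∣ f a ∣)

  ℕ-choice : {P : ℕ → Set} → ((n : ℕ) → Dec (P n)) → ((n : ℕ) → isProp (P n)) →
    ∥ Σ ℕ P ∥ → Σ ℕ P
  ℕ-choice P? P-prop w with ∥∥-rec (Least-isProp fe P-prop) (λ (n , p) → least P? n p) w
  ... | n , p , _ = n , p

  findLeft : {A B : ℕ → Set} (s : (n : ℕ) → A n ⊎ B n) → ∥ Σ ℕ (λ n → ¬ B n) ∥ → Σ ℕ A
  findLeft s refuted with ℕ-choice (λ n → IsLeft? (s n)) (λ n → IsLeft-isProp (s n))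
                                  (∥∥-map (λ (n , ¬b) → n , left-unless-right (s n) ¬b) refuted)
  ... | n , left = n , fromLeft (s n) left

  module Cut (L U : ℚ → Set) where

    isDedekindCut-isProp : ((q : ℚ) → isProp (L q)) → ((r : ℚ) → isProp (U r)) →
      isProp (isDedekindCut T L U)
    isDedekindCut-isProp L-prop U-prop =
      ×-isProp (∥∥-isProp _) (×-isProp (∥∥-isProp _)
      (×-isProp (Π-isProp fe λ q → Π-isProp fe λ _ → Π-isProp fe λ _ → L-prop q)
      (×-isProp (Π-isProp fe λ r → Π-isProp fe λ _ → Π-isProp fe λ _ → U-prop r)
      (×-isProp (Π-isProp fe λ _ → Π-isProp fe λ _ → ∥∥-isProp _)
      (×-isProp (Π-isProp fe λ _ → Π-isProp fe λ _ → ∥∥-isProp _)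
      (×-isProp (Π-isProp fe λ _ → Π-isProp fe λ _ → Π-isProp fe λ _ → <-irrelevant)
                (Π-isProp fe λ _ → Π-isProp fe λ _ → Π-isProp fe λ _ → ∥∥-isProp _)))))))

    forget : isCutS L U → isDedekindCut T L U
    forget (q , r , lower , upper , rounded-L , rounded-U , separated , loc) =
      ∣ q ∣ , ∣ r ∣ , lower , upper , (λ q l → ∣ rounded-L q l ∣) ,
      (λ r u → ∣ rounded-U r u ∣) , separated , (λ q r q<r → ∣ loc q r q<r ∣)

    module Locating (separated : (q r : ℚ) → L q × U r → q < r) (loc : locator L U) where

      ladder-L : (p : ℕ → ℚ) → ((n : ℕ) → p (suc n) < p n) →
        ∥ Σ ℚ (λ q → L q × Σ ℕ (λ N → p N < q)) ∥ → Σ ℕ (λ n → L (p (suc n)))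
      ladder-L p descending hint =
        findLeft (λ n → loc (p (suc n)) (p n) (descending n)) (∥∥-map not-in-U hint)
        where
        not-in-U : Σ ℚ (λ q → L q × Σ ℕ (λ N → p N < q)) → Σ ℕ (λ n → ¬ U (p n))
        not-in-U (q , q∈L , N , pN<q) = N , λ pN∈U → <-asym (separated q (p N) (q∈L , pN∈U)) pN<q

      ladder-U : (p : ℕ → ℚ) → ((n : ℕ) → p n < p (suc n)) →
        ∥ Σ ℚ (λ r → U r × Σ ℕ (λ N → r < p N)) ∥ → Σ ℕ (λ n → U (p (suc n)))
      ladder-U p ascending hint =
        findLeft (λ n → swap (loc (p n) (p (suc n)) (ascending n))) (∥∥-map not-in-L hint)
        where
        not-in-L : Σ ℚ (λ r → U r × Σ ℕ (λ N → r < p N)) → Σ ℕ (λ n → ¬ L (p n))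
        not-in-L (r , r∈U , N , r<pN) = N , λ pN∈L → <-asym (separated (p N) r (pN∈L , r∈U)) r<pN

      witness-L : ∥ Σ ℚ L ∥ → Σ ℚ L
      witness-L h = - ι (suc (proj₁ found)) , proj₂ found
        where
        open ℚSolver.+-*-Solver
        below : Σ ℚ L → Σ ℚ (λ q → L q × Σ ℕ (λ N → - ι N < q))
        below (q , q∈L) =
          let (N , -q<N) = archimedean (- q)
          in q , q∈L , N , subst (- ι N <_) (solve 1 (λ q → :- (:- q) := q) refl q) (neg-antimono-< -q<N)
        found : Σ ℕ (λ n → L (- ι (suc n)))
        found = ladder-L (λ n → - ι n) (λ n → neg-antimono-< (ι-<-suc n)) (∥∥-map below h)

      witness-U : ∥ Σ ℚ U ∥ → Σ ℚ U
      witness-U h = ι (suc (proj₁ found)) , proj₂ found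
        where
        below : Σ ℚ U → Σ ℚ (λ r → U r × Σ ℕ (λ N → r < ι N))
        below (r , r∈U) = r , r∈U , archimedean r
        found : Σ ℕ (λ n → U (ι (suc n)))
        found = ladder-U ι ι-<-suc (∥∥-map below h)

      round-L : (q : ℚ) → ∥ Σ ℚ (λ q' → (q < q') × L q') ∥ → Σ ℚ (λ q' → (q < q') × L q')
      round-L q h = q + geom 1ℚ (suc (proj₁ found)) ,
                    <-+-pos q (geom-pos 1ℚ 0<1 (suc (proj₁ found))) , proj₂ found
        where
        nearer : Σ ℚ (λ q' → (q < q') × L q') → Σ ℚ (λ q' → L q' × Σ ℕ (λ N → q + geom 1ℚ N < q'))
        nearer (q' , q<q' , q'∈L) =
          let (N , small) = geom-vanishes 1ℚ 0<1 (q' - q) (gap-pos q<q')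
          in q' , q'∈L , N , +-below q q' (small N ℕP.≤-refl)
        found : Σ ℕ (λ n → L (q + geom 1ℚ (suc n)))
        found = ladder-L (λ n → q + geom 1ℚ n) (λ n → +-monoʳ-< q (geom-decreasing 1ℚ 0<1 n))
                         (∥∥-map nearer h)

      round-U : (r : ℚ) → ∥ Σ ℚ (λ r' → (r' < r) × U r') ∥ → Σ ℚ (λ r' → (r' < r) × U r')
      round-U r h = r - geom 1ℚ (suc (proj₁ found)) ,
                    -‿pos-< r (geom-pos 1ℚ 0<1 (suc (proj₁ found))) , proj₂ found
        where
        nearer : Σ ℚ (λ r' → (r' < r) × U r') → Σ ℚ (λ r' → U r' × Σ ℕ (λ N → r' < r - geom 1ℚ N))
        nearer (r' , r'<r , r'∈U) =
          let (N , small) = geom-vanishes 1ℚ 0<1 (r - r') (gap-pos r'<r)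
          in r' , r'∈U , N , -‿above r r' (small N ℕP.≤-refl)
        found : Σ ℕ (λ n → U (r - geom 1ℚ (suc n)))
        found = ladder-U (λ n → r - geom 1ℚ n)
                         (λ n → +-monoʳ-< r (neg-antimono-< (geom-decreasing 1ℚ 0<1 n)))
                         (∥∥-map nearer h)

    structure : isDedekindCut T L U → locator L U → isCutS L U
    structure (some-L , some-U , lower , upper , rounded-L , rounded-U , separated , _) loc =
      witness-L some-L , witness-U some-U , lower , upper ,
      (λ q l → round-L q (rounded-L q l)) , (λ r u → round-U r (rounded-U r u)) ,
      separated , loc
      where open Locating separated loc

    module Trisection (separated : (q r : ℚ) → L q × U r → q < r) (loc : locator L U) where

      record Bracket (width : ℚ) : Set where
        constructor bracket
        field
          lo hi : ℚ
          lo∈L : L lo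
          hi∈U : U hi
          hi-lo : hi - lo ≡ width

      -- Asked about the two inner third-points, the locator tells which outer
      -- third of the bracket may be discarded.
      trisect : {w : ℚ} → Bracket w → Bracket (w * ⅔)
      trisect {w} (bracket a b a∈L b∈U b-a) = decide (loc c₁ c₂ (<-+-pos c₁ third-pos))
        where
        open ℚSolver.+-*-Solver
        third : ℚ
        third = (b - a) * ⅓
        c₁ c₂ : ℚ
        c₁ = a + third
        c₂ = c₁ + third
        third-pos : 0ℚ < third
        third-pos = third-of-pos (gap-pos (separated a b (a∈L , b∈U)))
        upper-part : b - c₁ ≡ w * ⅔
        upper-part = trans (solve 2 (λ a b → b :- (a :+ (b :- a) :* con ⅓) := (b :- a) :* con ⅔) refl a b)
                           (cong (_* ⅔) b-a)
        lower-part : c₂ - a ≡ w * ⅔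
        lower-part = trans (solve 2 (λ a b → a :+ (b :- a) :* con ⅓ :+ (b :- a) :* con ⅓ :- a
                                              := (b :- a) :* con ⅔) refl a b)
                           (cong (_* ⅔) b-a)
        decide : L c₁ ⊎ U c₂ → Bracket (w * ⅔)
        decide (inj₁ c₁∈L) = bracket c₁ b c₁∈L b∈U upper-part
        decide (inj₂ c₂∈U) = bracket a c₂ a∈L c₂∈U lower-part

      module Approximation
        (lower : (q q' : ℚ) → (q < q') × L q' → L q)
        (upper : (r r' : ℚ) → (r' < r) × U r' → U r)
        (q₀ r₀ : ℚ) (q₀∈L : L q₀) (r₀∈U : U r₀) where

        w₀ : ℚ
        w₀ = r₀ - q₀

        w₀-pos : 0ℚ < w₀
        w₀-pos = gap-pos (separated q₀ r₀ (q₀∈L , r₀∈U))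

        brackets : (n : ℕ) → Bracket (geom w₀ n)
        brackets zero = bracket q₀ r₀ q₀∈L r₀∈U refl
        brackets (suc n) = trisect (brackets n)

        approx : ℕ → ℚ
        approx n = Bracket.lo (brackets n)

        modulus : ℚ → ℕ
        modulus ε with 0ℚ <? ε
        ... | yes ε>0 = proj₁ (geom-vanishes w₀ w₀-pos ε ε>0)
        ... | no _ = 0

        modulus-narrow : (ε : ℚ) → 0ℚ < ε → (n : ℕ) → modulus ε ℕ.≤ n → geom w₀ n < ε
        modulus-narrow ε ε>0 n with 0ℚ <? ε
        ... | yes ε>0' = proj₂ (geom-vanishes w₀ w₀-pos ε ε>0') n
        ... | no ε≯0 = ⊥-elim (ε≯0 ε>0)

        -- Every lower end lies below every upper end, so it exceeds any other
        -- lower end by less than the width of the latter's bracket.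
        approx-gap : (m n : ℕ) → approx m - approx n < geom w₀ n
        approx-gap m n = subst (approx m - approx n <_) (Bracket.hi-lo (brackets n))
          (+-monoˡ-< (- approx n)
            (separated (approx m) (Bracket.hi (brackets n))
                       (Bracket.lo∈L (brackets m) , Bracket.hi∈U (brackets n))))

        approx-cauchy : isCauchyWithModulus T approx modulus
        approx-cauchy ε ε>0 m n m-late n-late = abs-< (approx m - approx n) ε
          (<-trans (approx-gap m n) (modulus-narrow ε ε>0 n n-late))
          (subst (_< ε) (sym (neg-diff (approx m) (approx n)))
                 (<-trans (approx-gap n m) (modulus-narrow ε ε>0 m m-late)))
          where
          open ℚSolver.+-*-Solver
          neg-diff : (p q : ℚ) → - (p - q) ≡ q - p
          neg-diff = solve 2 (λ p q → :- (p :- q) := q :- p) refl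

        approx-limit : hasLimit T approx L U
        approx-limit ε ε>0 = ∣ modulus ε , (λ n n-late → below n , above n n-late) ∣
          where
          below : (n : ℕ) → L (approx n - ε)
          below n = lower (approx n - ε) (approx n) (-‿pos-< (approx n) ε>0 , Bracket.lo∈L (brackets n))
          above : (n : ℕ) → modulus ε ℕ.≤ n → U (approx n + ε)
          above n n-late = upper (approx n + ε) (Bracket.hi (brackets n))
            (<-+-from-gap (approx n) (Bracket.hi (brackets n))
              (subst (_< ε) (sym (Bracket.hi-lo (brackets n))) (modulus-narrow ε ε>0 n n-late)) ,
             Bracket.hi∈U (brackets n))

    cauchyApproximation : isCutS L U →
      Σ (Σ (ℕ → ℚ) (λ _ → ℚ → ℕ)) (λ fM →
        isCauchyWithModulus T (proj₁ fM) (proj₂ fM) × hasLimit T (proj₁ fM) L U)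
    cauchyApproximation ((q₀ , q₀∈L) , (r₀ , r₀∈U) , lower , upper , _ , _ , separated , loc) =
      (approx , modulus) , approx-cauchy , approx-limit
      where open Trisection.Approximation separated loc lower upper q₀ r₀ q₀∈L r₀∈U

    cauchyReal : isDedekindCut T L U → ∥ locator L U ∥ → isCauchyReal T L U
    cauchyReal cut has-locator = cut , ∥∥-map (λ loc → cauchyApproximation (structure cut loc)) has-locator

theorem3p44 : (T : PropTrunc) → FunExt → PropExt →
    (L U : ℚ → Set) → ((q : ℚ) → isProp (L q)) → ((r : ℚ) → isProp (U r)) →
      (isCutS L U → isDedekindCut T L U)
    × (PropTrunc.∥_∥ T (isCutS L U) → isDedekindCut T L U)
    × (isDedekindCut T L U × locator L U → isCutS L U)
    × (isDedekindCut T L U × PropTrunc.∥_∥ T (locator L U) → isCauchyReal T L U)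
    × (PropTrunc.∥_∥ T (isCutS L U) → isCauchyReal T L U)
theorem3p44 T fe _ L U L-prop U-prop =
  forget , forget-truncated , (λ (cut , loc) → structure cut loc) ,
  (λ (cut , has-locator) → cauchyReal cut has-locator) ,
  (λ s → cauchyReal (forget-truncated s) (∥∥-map locatorOf s))
  where
  open WithTruncation T fe
  open PropTrunc T
  open Cut L U
  forget-truncated : ∥ isCutS L U ∥ → isDedekindCut T L U
  forget-truncated = ∥∥-rec (isDedekindCut-isProp L-prop U-prop) forget
  locatorOf : isCutS L U → locator L U
  locatorOf (_ , _ , _ , _ , _ , _ , _ , loc) = loc
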